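{- Let $h\ge -1$ be an integer and $n\ge 0$ an integer, with $(n,h)\neq(0,-1)$. The number of partitions $\lambda=(\lambda_1,\dots,\lambda_t)\vdash n$ having an $h$-fixed hook arising from a part of size $1$ (i.e. there is $s$ with $1\le s\le t$, $h_{s,1}(\lambda)=s+h$ and $\lambda_s=1$) equals the number of partitions of $n$ in which the part $1$ appears exactly $h+1$ times.
   Context: A partition $\lambda=(\lambda_1,\dots,\lambda_t)$ of $n$ is a nonincreasing sequence of positive integers with sum $n$. First-column hook lengths: $h_{s,1}(\lambda)=\lambda_s+t-s$ for $1\le s\le t$. For $h\in\mathbb{Z}$, an $h$-fixed hook is an index $s$ with $h_{s,1}(\lambda)=s+h$. -}

module Defs where

open import Data.Nat as ℕ using (ℕ; suc; _≥_; _≤_)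
open import Data.Integer as ℤ using (ℤ; +_; _-_)
open import Data.List using (List; length; lookup; filter)
open import Data.Nat.ListAction using (sum)
open import Data.List.Relation.Unary.All using (All)
open import Data.List.Relation.Unary.Linked using (Linked)
open import Data.Fin using (Fin; toℕ)
open import Data.Product using (Σ; ∃-syntax; _×_)
open import Relation.Binary.PropositionalEquality using (_≡_)

record IsPartition (n : ℕ) (lam : List ℕ) : Set where
  field
    nonincreasing : Linked _≥_ lam
    positive      : All (1 ≤_) lam
    sums          : sum lam ≡ n

Partition : ℕ → Set
Partition n = Σ (List ℕ) (IsPartition n)

row : ∀ {t} → Fin t → ℕ
row i = suc (toℕ i)

-- First-column hook length h_{s,1}(λ) = λ_s + t - s (in ℤ), s = row i.
hook₁ : (lam : List ℕ) → Fin (length lam) → ℤ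
hook₁ lam i = (+ lookup lam i ℤ.+ + length lam) - + row i

HasFixedHookFromPartOne : ℤ → List ℕ → Set
HasFixedHookFromPartOne h lam =
  ∃[ i ] (hook₁ lam i ≡ + row i ℤ.+ h × lookup lam i ≡ 1)

multOne : List ℕ → ℕ
multOne lam = length (filter (ℕ._≟ 1) lam)

module Submission where

open import Defs
open import Data.Nat as ℕ
  using (ℕ; zero; suc; pred; _+_; _*_; _∸_; _≤_; _<_; _≥_; z≤n; s≤s; z<s; _<?_; ⌊_/2⌋)
open import Data.Nat.Properties
open import Data.Nat.ListAction using (sum)
open import Data.Nat.ListAction.Properties using (sum-++)
open import Data.Nat.Tactic.RingSolver using (solve-∀)
open import Data.Integer as ℤ using (ℤ; +_; -[1+_]; _⊖_)
import Data.Integer.Properties as ℤ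
open import Data.Fin using (Fin; toℕ; fromℕ<)
open import Data.Fin.Properties using (toℕ-fromℕ<; toℕ-injective)
open import Data.List using (List; []; _∷_; _++_; map; replicate; length; lookup; filter)
open import Data.List.Properties
  using (filter-accept; filter-reject; filter-none; filter-all; filter-++;
         length-++; length-replicate; ++-identityʳ; map-∘; map-id)
open import Data.List.Relation.Unary.All as All using (All; []; _∷_)
open import Data.List.Relation.Unary.All.Properties as All using (++⁺; replicate⁺; all-filter)
open import Data.List.Relation.Unary.Linked as Linked using (Linked; []; [-]; _∷_)
open import Data.List.Relation.Unary.Linked.Properties as Linked using (Linked⇒All; filter⁺)
open import Data.Product using (Σ; ∃-syntax; _×_; _,_; proj₁; proj₂)
open import Data.Sum using (inj₁; inj₂)
open import Function using (_∘_; flip)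
open import Function.Bundles using (_↔_; mk↔ₛ′; _⇔_; mk⇔; Equivalence)
open import Axiom.UniquenessOfIdentityProofs using (module Decidable⇒UIP)
open import Relation.Binary.PropositionalEquality
open import Relation.Nullary using (¬_; Irrelevant; contradiction)

-- Put c = h + 1 ≥ 0 and write a partition with t parts as λ = B 1^m, where B lists the k parts
-- larger than 1. A part 1 in row s = i + 1 gives an h-fixed hook iff 1 + t - s = s + h, i.e.
-- t = 2i + c. Such an i ≥ k exists iff m = k + c + 2j for some j (and λ ≠ ∅), and it is then
-- unique, i = k + j. The map B 1^(k+c+2j) ↦ (B + 1) 2^j 1^c adds one to each part of B (using
-- k ones), glues 2j further ones into j twos and keeps c = h + 1 ones; it preserves the size
-- and is inverted by C 2^j 1^c ↦ (C - 1) 1^(|C|+c+2j), where C lists the parts larger than 2.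

count : ℕ → List ℕ → ℕ
count v xs = length (filter (ℕ._≟ v) xs)

partsAbove : ℕ → List ℕ → List ℕ
partsAbove v = filter (v <?_)

Nonincreasing : List ℕ → Set
Nonincreasing = Linked _≥_

≥-trans : ∀ {x y z} → x ≥ y → y ≥ z → x ≥ z
≥-trans = flip ≤-trans

partsAbove-++-replicate : ∀ {v w xs} m → All (v <_) xs → w ≤ v →
                          partsAbove v (xs ++ replicate m w) ≡ xs
partsAbove-++-replicate {v} {w} {xs} m v<xs w≤v = begin
  partsAbove v (xs ++ replicate m w)               ≡⟨ filter-++ (v <?_) xs (replicate m w) ⟩
  partsAbove v xs ++ partsAbove v (replicate m w)  ≡⟨ cong₂ _++_ (filter-all (v <?_) v<xs)
                                                        (filter-none (v <?_) (replicate⁺ m (≤⇒≯ w≤v))) ⟩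
  xs ++ []                                         ≡⟨ ++-identityʳ xs ⟩
  xs                                               ∎
  where open ≡-Reasoning

count-++-replicate : ∀ {v xs} m → All (v <_) xs → count v (xs ++ replicate m v) ≡ m
count-++-replicate {v} {xs} m v<xs = begin
  count v (xs ++ replicate m v)
    ≡⟨ cong length (filter-++ (ℕ._≟ v) xs (replicate m v)) ⟩
  length (filter (ℕ._≟ v) xs ++ filter (ℕ._≟ v) (replicate m v))
    ≡⟨ cong₂ (λ ys zs → length (ys ++ zs)) (filter-none (ℕ._≟ v) (All.map >⇒≢ v<xs))
                                            (filter-all (ℕ._≟ v) (replicate⁺ m refl)) ⟩
  length (replicate m v)
    ≡⟨ length-replicate m ⟩
  m ∎
  where open ≡-Reasoning

split-minimum : ∀ v {xs} → Nonincreasing xs → All (v ≤_) xs →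
                xs ≡ partsAbove v xs ++ replicate (count v xs) v
split-minimum v {[]}     _      _             = refl
split-minimum v {x ∷ xs} sorted (v≤x ∷ v≤xs) with m≤n⇒m<n∨m≡n v≤x
... | inj₁ v<x = begin
  x ∷ xs                                           ≡⟨ cong (x ∷_) ih ⟩
  x ∷ partsAbove v xs ++ replicate (count v xs) v  ≡⟨ cong₂ (λ ys k → ys ++ replicate k v)
       (sym (filter-accept (v <?_) v<x)) (cong length (sym (filter-reject (ℕ._≟ v) (>⇒≢ v<x)))) ⟩
  partsAbove v (x ∷ xs) ++ replicate (count v (x ∷ xs)) v ∎
  where
  open ≡-Reasoning
  ih = split-minimum v (Linked.tail sorted) v≤xs
... | inj₂ refl = begin
  v ∷ xs                                           ≡⟨ cong (v ∷_) ih ⟩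
  v ∷ partsAbove v xs ++ replicate (count v xs) v  ≡⟨ cong (λ ys → v ∷ ys ++ replicate (count v xs) v)
                                                          nothingAbove ⟩
  replicate (suc (count v xs)) v                   ≡⟨ cong₂ (λ ys k → ys ++ replicate k v)
       (sym (trans (filter-reject (v <?_) (<-irrefl refl)) nothingAbove))
       (cong length (sym (filter-accept (ℕ._≟ v) refl))) ⟩
  partsAbove v (v ∷ xs) ++ replicate (count v (v ∷ xs)) v ∎
  where
  open ≡-Reasoning
  ih = split-minimum v (Linked.tail sorted) v≤xs
  nothingAbove : partsAbove v xs ≡ []
  nothingAbove = filter-none (v <?_) (All.map ≤⇒≯ (All.tail (Linked⇒All ≥-trans ≤-refl sorted)))

++-replicate⁺ : ∀ {xs m v} → Nonincreasing xs → All (v ≤_) xs → Nonincreasing (xs ++ replicate m v)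
++-replicate⁺ {m = zero}        []             _          = []
++-replicate⁺ {m = suc zero}    []             _          = [-]
++-replicate⁺ {m = suc (suc m)} []             _          = ≤-refl ∷ ++-replicate⁺ {m = suc m} [] []
++-replicate⁺ {m = zero}        [-]            _          = [-]
++-replicate⁺ {m = suc m}       [-]            (v≤x ∷ []) = v≤x ∷ ++-replicate⁺ [] []
++-replicate⁺                   (x≥y ∷ sorted) (_ ∷ v≤ys) = x≥y ∷ ++-replicate⁺ sorted v≤ys

length-++-replicate : ∀ xs {m} {v : ℕ} → length (xs ++ replicate m v) ≡ length xs + m
length-++-replicate xs {m} = trans (length-++ xs) (cong (_+_ (length xs)) (length-replicate m))

lookup-++-replicate : ∀ xs {m} {v : ℕ} (i : Fin (length (xs ++ replicate m v))) →
                      length xs ≤ toℕ i → lookup (xs ++ replicate m v) i ≡ v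
lookup-++-replicate []       {suc m} Fin.zero    _         = refl
lookup-++-replicate []       {suc m} (Fin.suc i) _         = lookup-++-replicate [] {m} i z≤n
lookup-++-replicate (x ∷ xs)         (Fin.suc i) (s≤s k≤i) = lookup-++-replicate xs i k≤i

lookup-++≡1⇒length≤ : ∀ {xs ys} (i : Fin (length (xs ++ ys))) → All (1 <_) xs →
                      lookup (xs ++ ys) i ≡ 1 → length xs ≤ toℕ i
lookup-++≡1⇒length≤ {[]}     i           _          _  = z≤n
lookup-++≡1⇒length≤ {x ∷ xs} Fin.zero    (1<x ∷ _)  eq = contradiction eq (>⇒≢ 1<x)
lookup-++≡1⇒length≤ {x ∷ xs} (Fin.suc i) (_ ∷ 1<xs) eq = s≤s (lookup-++≡1⇒length≤ i 1<xs eq)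

sum-replicate : ∀ m v → sum (replicate m v) ≡ m * v
sum-replicate zero    v = refl
sum-replicate (suc m) v = cong (_+_ v) (sum-replicate m v)

sum-++-replicate : ∀ xs m v → sum (xs ++ replicate m v) ≡ sum xs + m * v
sum-++-replicate xs m v = trans (sum-++ xs (replicate m v)) (cong (_+_ (sum xs)) (sum-replicate m v))

sum-map-suc : ∀ xs → sum (map suc xs) ≡ length xs + sum xs
sum-map-suc []       = refl
sum-map-suc (x ∷ xs) = cong suc (trans (cong (_+_ x) (sum-map-suc xs)) (swap x (length xs) (sum xs)))
  where
  swap : ∀ a b c → a + (b + c) ≡ b + (a + c)
  swap = solve-∀

map-suc-pred : ∀ {xs} → All (0 <_) xs → map suc (map pred xs) ≡ xs
map-suc-pred []          = refl
map-suc-pred (s≤s _ ∷ p) = cong (_ ∷_) (map-suc-pred p)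

map-pred-suc : ∀ xs → map pred (map suc xs) ≡ xs
map-pred-suc xs = trans (sym (map-∘ xs)) (map-id xs)

m+[m+c]-injective : ∀ c {m n} → m + (m + c) ≡ n + (n + c) → m ≡ n
m+[m+c]-injective c {m} {n} eq = begin
  m            ≡⟨ n≡⌊n+n/2⌋ m ⟩
  ⌊ m + m /2⌋  ≡⟨ cong ⌊_/2⌋ (+-cancelʳ-≡ c _ _ (trans (+-assoc m m c) (trans eq (sym (+-assoc n n c))))) ⟩
  ⌊ n + n /2⌋  ≡⟨ sym (n≡⌊n+n/2⌋ n) ⟩
  n            ∎
  where open ≡-Reasoning

⌊[m∸a]/2⌋≡j : ∀ {m} a j → m ≡ a + (j + j) → ⌊ (m ∸ a) /2⌋ ≡ j
⌊[m∸a]/2⌋≡j a j refl = trans (cong ⌊_/2⌋ (m+n∸m≡n a (j + j))) (sym (n≡⌊n+n/2⌋ j))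

k+j+[k+j+c]≡k+[k+c+[j+j]] : ∀ k j c → (k + j) + ((k + j) + c) ≡ k + (k + c + (j + j))
k+j+[k+j+c]≡k+[k+c+[j+j]] = solve-∀

[n+m]⊖n≡+m : ∀ n m → (n + m) ⊖ n ≡ + m
[n+m]⊖n≡+m n m = trans (ℤ.⊖-≥ (m≤m+n n m)) (cong +_ (m+n∸m≡n n m))

⊖≡+⇒ : ∀ {m n k} → m ⊖ n ≡ + k → m ≡ n + k
⊖≡+⇒ {m} {n} {k} eq = ℤ.+-injective (begin
  + m              ≡⟨ sym ([n+m]⊖n≡+m n m) ⟩
  (n + m) ⊖ n      ≡⟨ sym (ℤ.distribʳ-⊖-+-pos n m n) ⟩
  + n ℤ.+ (m ⊖ n)  ≡⟨ cong (ℤ._+_ (+ n)) eq ⟩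
  + (n + k)        ∎)
  where open ≡-Reasoning

PartitionsWith : (List ℕ → Set) → ℕ → Set
PartitionsWith P n = Σ (Partition n) (P ∘ proj₁)

isPartition-irrelevant : ∀ {n xs} → Irrelevant (IsPartition n xs)
isPartition-irrelevant record { nonincreasing = s  ; positive = p  ; sums = e  }
                       record { nonincreasing = s′ ; positive = p′ ; sums = e′ }
  rewrite Linked.irrelevant ≤-irrelevant s s′ | All.irrelevant ≤-irrelevant p p′ | ≡-irrelevant e e′
  = refl

PartitionsWith-≡ : ∀ {P n} → (∀ xs → Irrelevant (P xs)) → {x y : PartitionsWith P n} →
                   proj₁ (proj₁ x) ≡ proj₁ (proj₁ y) → x ≡ y
PartitionsWith-≡ P-irrelevant {(xs , p) , w} {(.xs , p′) , w′} refl =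
  cong₂ (λ p w → (xs , p) , w) (isPartition-irrelevant p p′) (P-irrelevant xs w w′)

hookForm : ℕ → List ℕ → ℕ → List ℕ
hookForm c B j = B ++ replicate (length B + c + (j + j)) 1

onesForm : ℕ → List ℕ → ℕ → List ℕ
onesForm c C j = (C ++ replicate j 2) ++ replicate c 1

-- On hookForm c B j, which has |B| + c + 2j ones, this recovers j.
surplusPairs : ℕ → List ℕ → ℕ
surplusPairs c lam = ⌊ (count 1 lam ∸ (length (partsAbove 1 lam) + c)) /2⌋

toOnesForm : ℕ → List ℕ → List ℕ
toOnesForm c lam = onesForm c (map suc (partsAbove 1 lam)) (surplusPairs c lam)

toHookForm : ℕ → List ℕ → List ℕ
toHookForm c mu = hookForm c (map pred (partsAbove 2 (partsAbove 1 mu))) (count 2 (partsAbove 1 mu))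

hookForm-isPartition : ∀ {n c B j} → Nonincreasing B → All (1 ≤_) B → sum (hookForm c B j) ≡ n →
                       IsPartition n (hookForm c B j)
hookForm-isPartition sorted 1≤B sums = record
  { nonincreasing = ++-replicate⁺ sorted 1≤B
  ; positive      = ++⁺ 1≤B (replicate⁺ _ ≤-refl)
  ; sums          = sums
  }

onesForm-isPartition : ∀ {n c C j} → Nonincreasing C → All (1 <_) C → sum (onesForm c C j) ≡ n →
                       IsPartition n (onesForm c C j)
onesForm-isPartition {j = j} sorted 1<C sums = record
  { nonincreasing = ++-replicate⁺ (++-replicate⁺ sorted 1<C) 1≤C2ʲ
  ; positive      = ++⁺ 1≤C2ʲ (replicate⁺ _ ≤-refl)
  ; sums          = sums
  }
  where 1≤C2ʲ = ++⁺ (All.map <⇒≤ 1<C) (replicate⁺ j (s≤s z≤n))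

sum-hookForm : ∀ c B j → sum (hookForm c B j) ≡ sum (onesForm c (map suc B) j)
sum-hookForm c B j = begin
  sum (hookForm c B j)                      ≡⟨ sum-++-replicate B _ 1 ⟩
  sum B + (k + c + (j + j)) * 1             ≡⟨ regroup k (sum B) c j ⟩
  ((k + sum B) + j * 2) + c * 1             ≡⟨ cong (λ s → (s + j * 2) + c * 1) (sym (sum-map-suc B)) ⟩
  (sum (map suc B) + j * 2) + c * 1         ≡⟨ cong (_+ c * 1) (sym (sum-++-replicate (map suc B) j 2)) ⟩
  sum (map suc B ++ replicate j 2) + c * 1  ≡⟨ sym (sum-++-replicate (map suc B ++ replicate j 2) c 1) ⟩
  sum (onesForm c (map suc B) j)            ∎
  where
  open ≡-Reasoning
  k = length B
  regroup : ∀ k s c j → s + (k + c + (j + j)) * 1 ≡ ((k + s) + j * 2) + c * 1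
  regroup = solve-∀

-- The only use of (n, h) ≠ (0, -1): the empty partition has h + 1 = 0 ones but no hook at all.
hookForm-nonempty : ∀ {n c} B j → sum (hookForm c B j) ≡ n → ¬ (n ≡ 0 × c ≡ 0) → 0 < length B + j + c
hookForm-nonempty             (_ ∷ _) _       _    _    = z<s
hookForm-nonempty             []      (suc _) _    _    = z<s
hookForm-nonempty {c = suc _} []      zero    _    _    = z<s
hookForm-nonempty {c = zero}  []      zero    refl n≢0  = contradiction (refl , refl) n≢0

toOnesForm-hookForm : ∀ c {B} j → All (1 <_) B → toOnesForm c (hookForm c B j) ≡ onesForm c (map suc B) j
toOnesForm-hookForm c {B} j 1<B = cong₂ (λ B′ j′ → onesForm c (map suc B′) j′) partsAbove≡B surplus≡j
  where
  m = length B + c + (j + j)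
  partsAbove≡B : partsAbove 1 (hookForm c B j) ≡ B
  partsAbove≡B = partsAbove-++-replicate m 1<B ≤-refl
  surplus≡j : surplusPairs c (hookForm c B j) ≡ j
  surplus≡j = ⌊[m∸a]/2⌋≡j (length (partsAbove 1 (hookForm c B j)) + c) j
    (trans (count-++-replicate m 1<B) (cong (λ B′ → length B′ + c + (j + j)) (sym partsAbove≡B)))

toHookForm-onesForm : ∀ c {C} j → All (2 <_) C → toHookForm c (onesForm c C j) ≡ hookForm c (map pred C) j
toHookForm-onesForm c {C} j 2<C = cong₂ (λ C′ j′ → hookForm c (map pred C′) j′)
  (trans (cong (partsAbove 2) partsAbove1≡) (partsAbove-++-replicate j 2<C ≤-refl))
  (trans (cong (count 2) partsAbove1≡) (count-++-replicate j 2<C))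
  where
  partsAbove1≡ : partsAbove 1 (onesForm c C j) ≡ C ++ replicate j 2
  partsAbove1≡ = partsAbove-++-replicate c (++⁺ (All.map <⇒≤ 2<C) (replicate⁺ j ≤-refl)) ≤-refl

count1-onesForm : ∀ c {C} j → All (1 <_) C → count 1 (onesForm c C j) ≡ c
count1-onesForm c j 1<C = count-++-replicate c (++⁺ 1<C (replicate⁺ j ≤-refl))

onesForm-decomposition : ∀ {mu} → Nonincreasing mu → All (1 ≤_) mu →
  mu ≡ onesForm (count 1 mu) (partsAbove 2 (partsAbove 1 mu)) (count 2 (partsAbove 1 mu))
onesForm-decomposition {mu} sorted 1≤mu = trans (split-minimum 1 sorted 1≤mu)
  (cong (_++ replicate (count 1 mu) 1)
        (split-minimum 2 (filter⁺ (1 <?_) ≥-trans sorted) (all-filter (1 <?_) mu)))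

toOnesForm-toHookForm : ∀ {c mu} → Nonincreasing mu → All (1 ≤_) mu → count 1 mu ≡ c →
                        toOnesForm c (toHookForm c mu) ≡ mu
toOnesForm-toHookForm {c} {mu} sorted 1≤mu ones = begin
  toOnesForm c (hookForm c (map pred C) j)  ≡⟨ toOnesForm-hookForm c j (All.map⁺ (All.map pred-mono-≤ 2<C)) ⟩
  onesForm c (map suc (map pred C)) j       ≡⟨ cong (λ C′ → onesForm c C′ j)
                                                    (map-suc-pred (All.map (≤-trans z<s) 2<C)) ⟩
  onesForm c C j                            ≡⟨ cong (λ c′ → onesForm c′ C j) (sym ones) ⟩
  onesForm (count 1 mu) C j                 ≡⟨ sym (onesForm-decomposition sorted 1≤mu) ⟩
  mu                                        ∎
  where
  open ≡-Reasoning
  C = partsAbove 2 (partsAbove 1 mu)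
  j = count 2 (partsAbove 1 mu)
  2<C = all-filter (2 <?_) (partsAbove 1 mu)

module _ {h : ℤ} {c : ℕ} (hc : h ℤ.+ + 1 ≡ + c) where

  hook-fixed⇔ : ∀ a t i → (+ a ℤ.+ + t) ℤ.- + suc i ≡ + suc i ℤ.+ h ⇔ a + t ≡ suc i + (i + c)
  hook-fixed⇔ a t i = mk⇔
    (λ eq → ⊖≡+⇒ (trans (sym (ℤ.m-n≡m⊖n (a + t) (suc i))) (trans eq shift)))
    (λ eq → trans (ℤ.m-n≡m⊖n (a + t) (suc i))
                  (trans (cong (_⊖ suc i) eq) (trans ([n+m]⊖n≡+m (suc i) (i + c)) (sym shift))))
    where
    shift : + suc i ℤ.+ h ≡ + (i + c)
    shift = begin
      (+ 1 ℤ.+ + i) ℤ.+ h  ≡⟨ cong (ℤ._+ h) (ℤ.+-comm (+ 1) (+ i)) ⟩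
      (+ i ℤ.+ + 1) ℤ.+ h  ≡⟨ ℤ.+-assoc (+ i) (+ 1) h ⟩
      + i ℤ.+ (+ 1 ℤ.+ h)  ≡⟨ cong (ℤ._+_ (+ i)) (trans (ℤ.+-comm (+ 1) h) hc) ⟩
      + (i + c)            ∎
      where open ≡-Reasoning

  hookFromOne-fixed⇔ : ∀ lam (i : Fin (length lam)) → lookup lam i ≡ 1 →
                       hook₁ lam i ≡ + row i ℤ.+ h ⇔ length lam ≡ toℕ i + (toℕ i + c)
  hookFromOne-fixed⇔ lam i one = mk⇔
    (λ eq → suc-injective (trans (cong (_+ length lam) (sym one)) (to eq)))
    (λ eq → from (trans (cong (_+ length lam) one) (cong suc eq)))
    where open Equivalence (hook-fixed⇔ (lookup lam i) (length lam) (toℕ i))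

  fixedHook-length : ∀ lam ((i , _) : HasFixedHookFromPartOne h lam) → length lam ≡ toℕ i + (toℕ i + c)
  fixedHook-length lam (i , e , one) = Equivalence.to (hookFromOne-fixed⇔ lam i one) e

  fixedHookFromPartOne-irrelevant : ∀ lam → Irrelevant (HasFixedHookFromPartOne h lam)
  fixedHookFromPartOne-irrelevant lam w@(i , e , one) w′@(i′ , e′ , one′)
    with toℕ-injective {i = i} {j = i′}
           (m+[m+c]-injective c (trans (sym (fixedHook-length lam w)) (fixedHook-length lam w′)))
  ... | refl = cong₂ (λ e one → i , e , one) (Decidable⇒UIP.≡-irrelevant ℤ._≟_ e e′) (≡-irrelevant one one′)

  fixedHook⇒ones : ∀ {B m} → All (1 <_) B → HasFixedHookFromPartOne h (B ++ replicate m 1) →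
                   ∃[ j ] m ≡ length B + c + (j + j)
  fixedHook⇒ones {B} {m} 1<B w@(i , _ , one) = j , +-cancelˡ-≡ k _ _ (begin
    k + m                        ≡⟨ sym (length-++-replicate B) ⟩
    length (B ++ replicate m 1)  ≡⟨ fixedHook-length (B ++ replicate m 1) w ⟩
    toℕ i + (toℕ i + c)          ≡⟨ cong (λ x → x + (x + c)) (sym (m+[n∸m]≡n k≤i)) ⟩
    (k + j) + ((k + j) + c)      ≡⟨ k+j+[k+j+c]≡k+[k+c+[j+j]] k j c ⟩
    k + (k + c + (j + j))        ∎)
    where
    open ≡-Reasoning
    k = length B
    k≤i = lookup-++≡1⇒length≤ i 1<B one
    j = toℕ i ∸ k

  hookForm-fixedHook : ∀ B j → 0 < length B + j + c → HasFixedHookFromPartOne h (hookForm c B j)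
  hookForm-fixedHook B j pos = i , Equivalence.from (hookFromOne-fixed⇔ lam i one) len , one
    where
    k = length B
    lam = hookForm c B j
    len≡ : length lam ≡ (k + j) + ((k + j) + c)
    len≡ = trans (length-++-replicate B) (sym (k+j+[k+j+c]≡k+[k+c+[j+j]] k j c))
    i : Fin (length lam)
    i = fromℕ< (subst (k + j <_) (sym len≡) (m<m+n (k + j) pos))
    i≡k+j : toℕ i ≡ k + j
    i≡k+j = toℕ-fromℕ< _
    one : lookup lam i ≡ 1
    one = lookup-++-replicate B i (subst (k ≤_) (sym i≡k+j) (m≤m+n k j))
    len : length lam ≡ toℕ i + (toℕ i + c)
    len = trans len≡ (cong (λ x → x + (x + c)) (sym i≡k+j))

  hookForm-decomposition : ∀ {lam} → Nonincreasing lam → All (1 ≤_) lam → HasFixedHookFromPartOne h lam →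
                           lam ≡ hookForm c (partsAbove 1 lam) (surplusPairs c lam)
  hookForm-decomposition {lam} sorted 1≤lam w = begin
    lam                                        ≡⟨ split ⟩
    B ++ replicate (count 1 lam) 1             ≡⟨ cong (λ m → B ++ replicate m 1) m≡ ⟩
    B ++ replicate (length B + c + (j + j)) 1  ≡⟨ cong (hookForm c B) (sym (⌊[m∸a]/2⌋≡j (length B + c) j m≡)) ⟩
    hookForm c B (surplusPairs c lam)          ∎
    where
    open ≡-Reasoning
    B = partsAbove 1 lam
    split = split-minimum 1 sorted 1≤lam
    ones = fixedHook⇒ones (all-filter (1 <?_) lam) (subst (HasFixedHookFromPartOne h) split w)
    j = proj₁ ones
    m≡ = proj₂ ones

  toHookForm-toOnesForm : ∀ {lam} → Nonincreasing lam → All (1 ≤_) lam → HasFixedHookFromPartOne h lam →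
                          toHookForm c (toOnesForm c lam) ≡ lam
  toHookForm-toOnesForm {lam} sorted 1≤lam w = begin
    toHookForm c (onesForm c (map suc B) j)  ≡⟨ toHookForm-onesForm c j (All.map⁺ (All.map s≤s 1<B)) ⟩
    hookForm c (map pred (map suc B)) j      ≡⟨ cong (λ B′ → hookForm c B′ j) (map-pred-suc B) ⟩
    hookForm c B j                           ≡⟨ sym (hookForm-decomposition sorted 1≤lam w) ⟩
    lam                                      ∎
    where
    open ≡-Reasoning
    B = partsAbove 1 lam
    j = surplusPairs c lam
    1<B = all-filter (1 <?_) lam

  MultOne≡h+1 : List ℕ → Set
  MultOne≡h+1 mu = + multOne mu ≡ h ℤ.+ + 1

  toMultOne : ∀ {n} → PartitionsWith (HasFixedHookFromPartOne h) n → PartitionsWith MultOne≡h+1 n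
  toMultOne {n} ((lam , p) , w) = (toOnesForm c lam , onesForm-isPartition sortedB 1<B sums′) , ones
    where
    open IsPartition p
    B = partsAbove 1 lam
    j = surplusPairs c lam
    sortedB : Nonincreasing (map suc B)
    sortedB = Linked.map⁺ (Linked.map s≤s (filter⁺ (1 <?_) ≥-trans nonincreasing))
    1<B : All (1 <_) (map suc B)
    1<B = All.map⁺ (All.map m≤n⇒m≤1+n (all-filter (1 <?_) lam))
    sums′ : sum (toOnesForm c lam) ≡ n
    sums′ = trans (sym (sum-hookForm c B j))
                  (trans (cong sum (sym (hookForm-decomposition nonincreasing positive w))) sums)
    ones : MultOne≡h+1 (toOnesForm c lam)
    ones = trans (cong +_ (count1-onesForm c j 1<B)) (sym hc)

  toFixedHook : ∀ {n} → ¬ (n ≡ 0 × c ≡ 0) →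
                PartitionsWith MultOne≡h+1 n → PartitionsWith (HasFixedHookFromPartOne h) n
  toFixedHook {n} n,c≢0 ((mu , p) , e) =
    (toHookForm c mu , hookForm-isPartition {j = j} sortedB (All.map <⇒≤ 1<B) sums′) , hook
    where
    open IsPartition p
    L = partsAbove 1 mu
    B = map pred (partsAbove 2 L)
    j = count 2 L
    sortedB : Nonincreasing B
    sortedB = Linked.map⁺ (Linked.map pred-mono-≤
                (filter⁺ (2 <?_) ≥-trans (filter⁺ (1 <?_) ≥-trans nonincreasing)))
    1<B : All (1 <_) B
    1<B = All.map⁺ (All.map pred-mono-≤ (all-filter (2 <?_) L))
    sums′ : sum (toHookForm c mu) ≡ n
    sums′ = begin
      sum (hookForm c B j)                 ≡⟨ sum-hookForm c B j ⟩
      sum (onesForm c (map suc B) j)       ≡⟨ cong sum (sym (toOnesForm-hookForm c j 1<B)) ⟩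
      sum (toOnesForm c (hookForm c B j))  ≡⟨ cong sum (toOnesForm-toHookForm nonincreasing positive
                                                          (ℤ.+-injective (trans e hc))) ⟩
      sum mu                               ≡⟨ sums ⟩
      n                                    ∎
      where open ≡-Reasoning
    hook : HasFixedHookFromPartOne h (toHookForm c mu)
    hook = hookForm-fixedHook B j (hookForm-nonempty B j sums′ n,c≢0)

  fixedHook↔multOne : ∀ {n} → ¬ (n ≡ 0 × c ≡ 0) →
                      PartitionsWith (HasFixedHookFromPartOne h) n ↔ PartitionsWith MultOne≡h+1 n
  fixedHook↔multOne n,c≢0 = mk↔ₛ′ toMultOne (toFixedHook n,c≢0) toMultOne∘toFixedHook toFixedHook∘toMultOne
    where
    toMultOne∘toFixedHook : ∀ y → toMultOne (toFixedHook n,c≢0 y) ≡ y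
    toMultOne∘toFixedHook ((mu , p) , e) =
      PartitionsWith-≡ {P = MultOne≡h+1} (λ _ → Decidable⇒UIP.≡-irrelevant ℤ._≟_)
        (toOnesForm-toHookForm nonincreasing positive (ℤ.+-injective (trans e hc)))
      where open IsPartition p
    toFixedHook∘toMultOne : ∀ x → toFixedHook n,c≢0 (toMultOne x) ≡ x
    toFixedHook∘toMultOne ((lam , p) , w) =
      PartitionsWith-≡ {P = HasFixedHookFromPartOne h} fixedHookFromPartOne-irrelevant
        (toHookForm-toOnesForm nonincreasing positive w)
      where open IsPartition p

mainTheorem3 : (h : ℤ) (n : ℕ) → -[1+ 0 ] ℤ.≤ h → ¬ (n ≡ 0 × h ≡ -[1+ 0 ]) →
    (Σ (Partition n) λ p → HasFixedHookFromPartOne h (proj₁ p))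
      ↔ (Σ (Partition n) λ p → + multOne (proj₁ p) ≡ h ℤ.+ + 1)
mainTheorem3 (+ k)        n _          _     = fixedHook↔multOne {h = + k} (cong +_ (+-comm k 1)) λ ()
mainTheorem3 -[1+ 0 ]     n _          n,h≢0 =
  fixedHook↔multOne {h = -[1+ 0 ]} refl λ (n≡0 , _) → n,h≢0 (n≡0 , refl)
mainTheorem3 -[1+ suc _ ] n (ℤ.-≤- ()) _
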